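{- Let $M$ be a matroid and let $N$ be a matroid whose ground set is the set of circuits of $M$. The following are equivalent: $(*')$ For every modular pair $\{C_1, C_2\}$ of circuits of $M$, each circuit $C$ of $M$ with $C \subseteq C_1 \cup C_2$ satisfies $C \in \operatorname{cl}_N(\{C_1, C_2\})$. $(*)$ For every perfect collection $\mathcal{C}'$ of circuits of $M$, each circuit $C$ of $M$ with $C \subseteq \bigcup_{C'\in\mathcal{C}'} C'$ satisfies $C \in \operatorname{cl}_N(\mathcal{C}')$.
   Context: A collection $\mathcal{C}'$ of circuits of $M$ is perfect if, writing $U = \bigcup_{C'\in\mathcal{C}'}C'$, we have $|U| - r_M(U) = |\mathcal{C}'|$ and no circuit in $\mathcal{C}'$ is contained in the union of the other circuits in $\mathcal{C}'$. A pair $\{C_1,C_2\}$ of circuits is a modular pair if $|C_1\cup C_2| - r_M(C_1\cup C_2) = 2$. $\operatorname{cl}_N$ is the closure operator of $N$. -}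

module Defs where

open import Data.Nat using (ℕ; zero; suc; _≤_; _+_; _∸_)
open import Data.Fin using (Fin; zero; suc)
open import Data.Fin.Subset using (Subset; _∈_; _⊆_; _⊂_; _∪_; _∩_; ⊥; ⁅_⁆; ∣_∣; _-_)
open import Data.Vec using (_∷_)
open import Data.Bool using (if_then_else_)
open import Data.Product using (Σ; _×_)
open import Relation.Binary.PropositionalEquality using (_≡_)
open import Relation.Nullary using (¬_)
open import Function.Definitions using (Injective)

record Matroid (n : ℕ) : Set where
  field
    r          : Subset n → ℕ
    r-bounded  : ∀ X → r X ≤ ∣ X ∣
    r-mono     : ∀ {X Y} → X ⊆ Y → r X ≤ r Y
    r-submod   : ∀ X Y → r (X ∪ Y) + r (X ∩ Y) ≤ r X + r Y

open Matroid public

module _ {n : ℕ} (M : Matroid n) where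

  Independent : Subset n → Set
  Independent X = r M X ≡ ∣ X ∣

  Dependent : Subset n → Set
  Dependent X = ¬ Independent X

  Circuit : Subset n → Set
  Circuit C = Dependent C × (∀ D → D ⊂ C → Independent D)


_∈cl[_]_ : ∀ {n} → Fin n → Matroid n → Subset n → Set
i ∈cl[ N ] X = r N (X ∪ ⁅ i ⁆) ≡ r N X

⋃[_]_ : ∀ {n m} → (Fin m → Subset n) → Subset m → Subset n
⋃[_]_ {m = zero}  e _        = ⊥
⋃[_]_ {m = suc m} e (b ∷ 𝒞) = (if b then e zero else ⊥) ∪ (⋃[ (λ i → e (suc i)) ] 𝒞)

-- e : Fin m → Subset n enumerates (bijectively) the circuits of M,
-- so that Fin m plays the role of the set of circuits of M
-- (the ground set of N).
record CircuitEnumeration {n m : ℕ} (M : Matroid n) (e : Fin m → Subset n) : Set where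
  field
    injective : Injective _≡_ _≡_ e
    isCircuit : ∀ i → Circuit M (e i)
    onto      : ∀ C → Circuit M C → Σ (Fin m) (λ i → e i ≡ C)

module _ {n m : ℕ} (M : Matroid n) (e : Fin m → Subset n) where

  Perfect : Subset m → Set
  Perfect 𝒞 = (∣ ⋃[ e ] 𝒞 ∣ ∸ r M (⋃[ e ] 𝒞) ≡ ∣ 𝒞 ∣)
            × (∀ i → i ∈ 𝒞 → ¬ (e i ⊆ ⋃[ e ] (𝒞 - i)))

  ModularPair : Fin m → Fin m → Set
  ModularPair i j = ∣ e i ∪ e j ∣ ∸ r M (e i ∪ e j) ≡ 2

  Star' : Matroid m → Set
  Star' N = ∀ i j → ModularPair i j →
            ∀ k → e k ⊆ (e i ∪ e j) → k ∈cl[ N ] (⁅ i ⁆ ∪ ⁅ j ⁆)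

  Star : Matroid m → Set
  Star N = ∀ 𝒞 → Perfect 𝒞 →
           ∀ k → e k ⊆ (⋃[ e ] 𝒞) → k ∈cl[ N ] 𝒞

-- (*) ⇒ (*'): a modular pair of circuits consists of two distinct circuits and is itself a
-- perfect collection.
--
-- (*') ⇒ (*): write η X = |X| - r X. Each member j of a perfect collection 𝒞 has a private
-- point π j lying in no other member. Deleting private points one at a time shows
-- η X + |𝒦| ≤ η U whenever the private points of 𝒦 avoid X ⊆ U, so any two members C_i, C_j
-- form a modular pair. Given a circuit C ⊆ U = ⋃ 𝒞 other than C_i, pick z ∈ C_i ∖ C.
-- Eliminating z from each pair {C_i, C_j} gives a circuit D_j ∋ π j inside (C_i ∪ C_j) - z,
-- and D_j ∈ cl_N {C_i, C_j} by (*'). The circuits D_j (j ≠ i), with the same private points,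
-- lie in U - z ⊇ C and η (U - z) ≤ |𝒞| - 1, so induction on |𝒞| puts C in the N-closure of
-- the D_j, which is contained in cl_N 𝒞.

module Submission where

open import Defs
open import Data.Nat using (ℕ; zero; suc; _≤_; _<_; _+_; _∸_; s≤s; s≤s⁻¹)
open import Data.Nat.Properties hiding (_≟_)
open import Data.Nat.Induction using (<-wellFounded)
open import Data.Fin using (Fin; zero; suc; _≟_)
open import Data.Fin.Properties using (any?)
open import Data.Fin.Subset
open import Data.Fin.Subset.Properties
open import Data.Vec using ([]; _∷_; here; there)
open import Data.Product using (∃; ∃-syntax; _×_; _,_; proj₁; proj₂)
open import Data.Sum using (_⊎_; inj₁; inj₂)
open import Data.Empty using (⊥-elim)
open import Function using (_∘_; id)
open import Function.Bundles using (_⇔_; mk⇔)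
open import Induction.WellFounded using (module All)
open import Relation.Binary.Construct.On as On using ()
open import Relation.Binary.PropositionalEquality
open import Relation.Nullary using (¬_; yes; no; contradiction)
open import Relation.Nullary.Decidable using (_×-dec_)

private
  variable
    n m k : ℕ

subset-rec : ∀ {ℓ} (P : Subset n → Set ℓ) →
             (∀ S → (∀ {x} → x ∈ S → P (S - x)) → P S) → ∀ S → P S
subset-rec P step = All.wfRec (On.wellFounded ∣_∣ <-wellFounded) _ P
  (λ S rec → step S (λ x∈S → rec (x∈p⇒∣p-x∣<∣p∣ x∈S)))

x∈p─q⇒x∉q : ∀ {x} (p q : Subset n) → x ∈ p ─ q → x ∉ q
x∈p─q⇒x∉q (inside ∷ p) (outside ∷ q) here        ()
x∈p─q⇒x∉q (_      ∷ p) (_       ∷ q) (there x∈) (there x∈q) = x∈p─q⇒x∉q p q x∈ x∈q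

x∈p-y⁻ : ∀ {x y} {p : Subset n} → x ∈ p - y → x ∈ p × x ≢ y
x∈p-y⁻ {y = y} {p = p} x∈ = p─q⊆p p ⁅ y ⁆ x∈ , λ { refl → x∈p─q⇒x∉q p ⁅ y ⁆ x∈ (x∈⁅x⁆ y) }

p⊆q⇒p-x⊆q-x : ∀ {p q : Subset n} x → p ⊆ q → p - x ⊆ q - x
p⊆q⇒p-x⊆q-x x p⊆q y∈ = let y∈p , y≢x = x∈p-y⁻ y∈ in x∈p∧x≢y⇒x∈p-y (p⊆q y∈p) y≢x

∪-lub : ∀ {p q r : Subset n} → p ⊆ r → q ⊆ r → p ∪ q ⊆ r
∪-lub {p = p} {q = q} p⊆r q⊆r x∈ with x∈p∪q⁻ p q x∈
... | inj₁ x∈p = p⊆r x∈p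
... | inj₂ x∈q = q⊆r x∈q

p⊈q⇒∃ : ∀ {p q : Subset n} → ¬ p ⊆ q → ∃[ x ] x ∈ p × x ∉ q
p⊈q⇒∃ {p = p} {q = q} p⊈q with nonempty? (p ─ q)
... | yes (x , x∈) = x , p─q⊆p p q x∈ , x∈p─q⇒x∉q p q x∈
... | no p─q-empty = ⊥-elim (p⊈q p⊆q)
  where
  p⊆q : p ⊆ q
  p⊆q {x} x∈p with x ∈? q
  ... | yes x∈q = x∈q
  ... | no x∉q = contradiction (x , x∈p∧x∉q⇒x∈p─q x∈p x∉q) p─q-empty

∣p∣≡1+∣p-x∣ : ∀ {x} (p : Subset n) → x ∈ p → ∣ p ∣ ≡ suc ∣ p - x ∣
∣p∣≡1+∣p-x∣ (inside  ∷ p) here       = cong (suc ∘ ∣_∣) (sym (p─⊥≡p p))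
∣p∣≡1+∣p-x∣ (outside ∷ p) (there x∈) = ∣p∣≡1+∣p-x∣ p x∈
∣p∣≡1+∣p-x∣ (inside  ∷ p) (there x∈) = cong suc (∣p∣≡1+∣p-x∣ p x∈)

⁅x⁆∪⁅y⁆⁻ : ∀ {x y z : Fin n} → z ∈ ⁅ x ⁆ ∪ ⁅ y ⁆ → z ≡ x ⊎ z ≡ y
⁅x⁆∪⁅y⁆⁻ {x = x} {y = y} z∈ with x∈p∪q⁻ ⁅ x ⁆ ⁅ y ⁆ z∈
... | inj₁ z∈⁅x⁆ = inj₁ (x∈⁅y⁆⇒x≡y x z∈⁅x⁆)
... | inj₂ z∈⁅y⁆ = inj₂ (x∈⁅y⁆⇒x≡y y z∈⁅y⁆)

∣p∣≡∣p∩q∣+∣p─q∣ : (p q : Subset n) → ∣ p ∣ ≡ ∣ p ∩ q ∣ + ∣ p ─ q ∣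
∣p∣≡∣p∩q∣+∣p─q∣ []            []            = refl
∣p∣≡∣p∩q∣+∣p─q∣ (inside  ∷ p) (inside  ∷ q) = cong suc (∣p∣≡∣p∩q∣+∣p─q∣ p q)
∣p∣≡∣p∩q∣+∣p─q∣ (inside  ∷ p) (outside ∷ q) =
  trans (cong suc (∣p∣≡∣p∩q∣+∣p─q∣ p q)) (sym (+-suc _ _))
∣p∣≡∣p∩q∣+∣p─q∣ (outside ∷ p) (inside  ∷ q) = ∣p∣≡∣p∩q∣+∣p─q∣ p q
∣p∣≡∣p∩q∣+∣p─q∣ (outside ∷ p) (outside ∷ q) = ∣p∣≡∣p∩q∣+∣p─q∣ p q

∣⁅x⁆∪⁅y⁆∣≡2 : {x y : Fin n} → x ≢ y → ∣ ⁅ x ⁆ ∪ ⁅ y ⁆ ∣ ≡ 2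
∣⁅x⁆∪⁅y⁆∣≡2 {x = zero}  {zero}  x≢y = contradiction refl x≢y
∣⁅x⁆∪⁅y⁆∣≡2 {x = zero}  {suc y} _   = cong suc (trans (cong ∣_∣ (∪-identityˡ ⁅ y ⁆)) (∣⁅x⁆∣≡1 y))
∣⁅x⁆∪⁅y⁆∣≡2 {x = suc x} {zero}  _   = cong suc (trans (cong ∣_∣ (∪-identityʳ ⁅ x ⁆)) (∣⁅x⁆∣≡1 x))
∣⁅x⁆∪⁅y⁆∣≡2 {x = suc x} {suc y} x≢y = ∣⁅x⁆∪⁅y⁆∣≡2 (x≢y ∘ cong suc)

choice : ∀ {a b} {A : Set a} {B : Fin n → A → Set b} (S : Subset n) → (Fin n → A) →
         (∀ {x} → x ∈ S → ∃ (B x)) → ∃[ f ] (∀ {x} → x ∈ S → B x (f x))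
choice {n = n} {A = A} {B} S default pick = f , f-spec
  where
  f : Fin n → A
  f x with x ∈? S
  ... | yes x∈S = proj₁ (pick x∈S)
  ... | no _    = default x
  f-spec : ∀ {x} → x ∈ S → B x (f x)
  f-spec {x} x∈S with x ∈? S
  ... | yes x∈S′ = proj₂ (pick x∈S′)
  ... | no x∉S   = contradiction x∈S x∉S

C⊆⋃ : ∀ (C : Fin m → Subset n) {𝒦 j} → j ∈ 𝒦 → C j ⊆ ⋃[ C ] 𝒦
C⊆⋃ C {inside ∷ 𝒦} here      x∈ = p⊆p∪q _ x∈
C⊆⋃ C {_      ∷ 𝒦} (there j∈) x∈ = q⊆p∪q _ _ (C⊆⋃ (C ∘ suc) j∈ x∈)

x∈⋃⁻ : ∀ (C : Fin m → Subset n) 𝒦 {x} → x ∈ ⋃[ C ] 𝒦 → ∃[ j ] j ∈ 𝒦 × x ∈ C j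
x∈⋃⁻ {m = zero}  C []            x∈ = contradiction x∈ ∉⊥
x∈⋃⁻ {m = suc m} C (inside  ∷ 𝒦) x∈ with x∈p∪q⁻ (C zero) _ x∈
... | inj₁ x∈C₀ = zero , here , x∈C₀
... | inj₂ x∈⋃ = let j , j∈ , x∈Cj = x∈⋃⁻ (C ∘ suc) 𝒦 x∈⋃ in suc j , there j∈ , x∈Cj
x∈⋃⁻ {m = suc m} C (outside ∷ 𝒦) x∈ with x∈p∪q⁻ ⊥ _ x∈
... | inj₁ x∈⊥ = contradiction x∈⊥ ∉⊥
... | inj₂ x∈⋃ = let j , j∈ , x∈Cj = x∈⋃⁻ (C ∘ suc) 𝒦 x∈⋃ in suc j , there j∈ , x∈Cj

⋃-⁅i⁆∪⁅j⁆ : ∀ (C : Fin m → Subset n) i j → ⋃[ C ] (⁅ i ⁆ ∪ ⁅ j ⁆) ≡ C i ∪ C j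
⋃-⁅i⁆∪⁅j⁆ C i j =
  ⊆-antisym ⋃⊆ (∪-lub (C⊆⋃ C (p⊆p∪q ⁅ j ⁆ (x∈⁅x⁆ i))) (C⊆⋃ C (q⊆p∪q ⁅ i ⁆ ⁅ j ⁆ (x∈⁅x⁆ j))))
  where
  ⋃⊆ : ⋃[ C ] (⁅ i ⁆ ∪ ⁅ j ⁆) ⊆ C i ∪ C j
  ⋃⊆ x∈ with x∈⋃⁻ C _ x∈
  ... | l , l∈ , x∈Cl with ⁅x⁆∪⁅y⁆⁻ l∈
  ...   | inj₁ refl = p⊆p∪q (C j) x∈Cl
  ...   | inj₂ refl = q⊆p∪q (C i) (C j) x∈Cl

⋃[⁅i⁆∪⁅j⁆-i]⊆ : ∀ (C : Fin m → Subset n) i j → ⋃[ C ] ((⁅ i ⁆ ∪ ⁅ j ⁆) - i) ⊆ C j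
⋃[⁅i⁆∪⁅j⁆-i]⊆ C i j x∈ with x∈⋃⁻ C _ x∈
... | l , l∈ , x∈Cl with x∈p-y⁻ l∈
...   | l∈⁅i,j⁆ , l≢i with ⁅x⁆∪⁅y⁆⁻ l∈⁅i,j⁆
...     | inj₁ l≡i  = contradiction l≡i l≢i
...     | inj₂ refl = x∈Cl

module Nullity {n : ℕ} (M : Matroid n) where

  private
    variable
      X Y S U C D : Subset n
      p z : Fin n
      𝒦 𝒦′ : Subset k
      i j : Fin k
      F : Fin k → Subset n
      π : Fin k → Fin n

  η : Subset n → ℕ
  η X = ∣ X ∣ ∸ r M X

  independent⇒η≡0 : Independent M X → η X ≡ 0
  independent⇒η≡0 {X} X-indep = trans (cong (∣ X ∣ ∸_) X-indep) (n∸n≡0 ∣ X ∣)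

  η≡0⇒independent : η X ≡ 0 → Independent M X
  η≡0⇒independent {X} ηX≡0 =
    ≤-antisym (r-bounded M X) (m∸n≡0⇒m≤n ηX≡0)

  ⊥-independent : Independent M ⊥
  ⊥-independent = trans (n≤0⇒n≡0 (subst (r M ⊥ ≤_) (∣⊥∣≡0 n) (r-bounded M ⊥))) (sym (∣⊥∣≡0 n))

  r-subadditive : ∀ X Y → r M (X ∪ Y) ≤ r M X + r M Y
  r-subadditive X Y = ≤-trans (m≤m+n _ _) (r-submod M X Y)

  η-mono : X ⊆ Y → η X ≤ η Y
  η-mono {X} {Y} X⊆Y = begin
    ∣ X ∣ ∸ r M X                     ≡⟨ [m+n]∸[m+o]≡n∸o ∣ Δ ∣ ∣ X ∣ (r M X) ⟨
    (∣ Δ ∣ + ∣ X ∣) ∸ (∣ Δ ∣ + r M X) ≤⟨ ∸-mono card≤ rank≤ ⟩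
    ∣ Y ∣ ∸ r M Y                     ∎
    where
    open ≤-Reasoning
    Δ : Subset n
    Δ = Y ─ X
    Y⊆X∪Δ : Y ⊆ X ∪ Δ
    Y⊆X∪Δ {x} x∈Y with x ∈? X
    ... | yes x∈X = p⊆p∪q Δ x∈X
    ... | no x∉X  = q⊆p∪q X Δ (x∈p∧x∉q⇒x∈p─q x∈Y x∉X)
    card≤ : ∣ Δ ∣ + ∣ X ∣ ≤ ∣ Y ∣
    card≤ = begin
      ∣ Δ ∣ + ∣ X ∣     ≤⟨ +-monoʳ-≤ ∣ Δ ∣ (p⊆q⇒∣p∣≤∣q∣ (λ x∈X → x∈p∩q⁺ (X⊆Y x∈X , x∈X))) ⟩
      ∣ Δ ∣ + ∣ Y ∩ X ∣ ≡⟨ +-comm ∣ Δ ∣ _ ⟩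
      ∣ Y ∩ X ∣ + ∣ Δ ∣ ≡⟨ ∣p∣≡∣p∩q∣+∣p─q∣ Y X ⟨
      ∣ Y ∣             ∎
    rank≤ : r M Y ≤ ∣ Δ ∣ + r M X
    rank≤ = begin
      r M Y         ≤⟨ r-mono M Y⊆X∪Δ ⟩
      r M (X ∪ Δ)   ≤⟨ r-subadditive X Δ ⟩
      r M X + r M Δ ≤⟨ +-monoʳ-≤ (r M X) (r-bounded M Δ) ⟩
      r M X + ∣ Δ ∣ ≡⟨ +-comm (r M X) ∣ Δ ∣ ⟩
      ∣ Δ ∣ + r M X ∎

  r-circuit-point : Circuit M C → z ∈ C → r M C ≡ r M (C - z)
  r-circuit-point {C} {z} (C-dep , C-minimal) z∈C = ≤-antisym r≤ (r-mono M (p─q⊆p C ⁅ z ⁆))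
    where
    r≤ : r M C ≤ r M (C - z)
    r≤ = subst (r M C ≤_) (sym (C-minimal (C - z) (x∈p⇒p-x⊂p z∈C)))
           (s≤s⁻¹ (subst (r M C <_) (∣p∣≡1+∣p-x∣ C z∈C) (≤∧≢⇒< (r-bounded M C) C-dep)))

  r-remove-circuit-point : Circuit M C → C ⊆ S → z ∈ C → r M S ≡ r M (S - z)
  r-remove-circuit-point {C} {S} {z} C-circ C⊆S z∈C =
    ≤-antisym (+-cancelʳ-≤ (r M (C - z)) _ _ rank≤) (r-mono M (p─q⊆p S ⁅ z ⁆))
    where
    open ≤-Reasoning
    S⊆ : S ⊆ (S - z) ∪ C
    S⊆ {x} x∈S with x ≟ z
    ... | yes refl = q⊆p∪q (S - z) C z∈C
    ... | no x≢z  = p⊆p∪q C (x∈p∧x≢y⇒x∈p-y x∈S x≢z)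
    C-z⊆ : C - z ⊆ (S - z) ∩ C
    C-z⊆ x∈ = x∈p∩q⁺ (p⊆q⇒p-x⊆q-x z C⊆S x∈ , p─q⊆p C ⁅ z ⁆ x∈)
    rank≤ : r M S + r M (C - z) ≤ r M (S - z) + r M (C - z)
    rank≤ = begin
      r M S + r M (C - z)                     ≤⟨ +-mono-≤ (r-mono M S⊆) (r-mono M C-z⊆) ⟩
      r M ((S - z) ∪ C) + r M ((S - z) ∩ C) ≤⟨ r-submod M (S - z) C ⟩
      r M (S - z) + r M C                     ≡⟨ cong (r M (S - z) +_) (r-circuit-point C-circ z∈C) ⟩
      r M (S - z) + r M (C - z)               ∎

  η-remove-circuit-point : Circuit M C → C ⊆ S → z ∈ C → η S ≡ suc (η (S - z))
  η-remove-circuit-point {C} {S} {z} C-circ C⊆S z∈C = begin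
    ∣ S ∣ ∸ r M S
      ≡⟨ cong₂ _∸_ (∣p∣≡1+∣p-x∣ S (C⊆S z∈C)) (r-remove-circuit-point C-circ C⊆S z∈C) ⟩
    suc ∣ S - z ∣ ∸ r M (S - z)  ≡⟨ +-∸-assoc 1 (r-bounded M (S - z)) ⟩
    suc (η (S - z))              ∎
    where open ≡-Reasoning

  circuit-nonempty : Circuit M C → Nonempty C
  circuit-nonempty {C} (C-dep , _) with nonempty? C
  ... | yes C-nonempty = C-nonempty
  ... | no C-empty     =
    contradiction (subst (Independent M) (sym (Empty-unique C-empty)) ⊥-independent) C-dep

  η-circuit : Circuit M C → η C ≡ 1
  η-circuit {C} C-circ with circuit-nonempty C-circ
  ... | z , z∈C = trans (η-remove-circuit-point C-circ ⊆-refl z∈C)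
                        (cong suc (independent⇒η≡0 (proj₂ C-circ (C - z) (x∈p⇒p-x⊂p z∈C))))

  circuit-⊆⇒≡ : Circuit M C → Circuit M D → C ⊆ D → C ≡ D
  circuit-⊆⇒≡ {C} {D} (C-dep , _) (_ , D-minimal) C⊆D with D ⊆? C
  ... | yes D⊆C = ⊆-antisym C⊆D D⊆C
  ... | no D⊈C  = contradiction (D-minimal C (C⊆D , p⊈q⇒∃ D⊈C)) C-dep

  circuit-⊆ : ∀ S → 0 < η S → ∃[ D ] Circuit M D × D ⊆ S
  circuit-⊆ = subset-rec (λ S → 0 < η S → ∃[ D ] Circuit M D × D ⊆ S) step
    where
    step : ∀ S → (∀ {x} → x ∈ S → 0 < η (S - x) → ∃[ D ] Circuit M D × D ⊆ S - x) →
           0 < η S → ∃[ D ] Circuit M D × D ⊆ S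
    step S rec 0<ηS with any? (λ x → (x ∈? S) ×-dec (0 <? η (S - x)))
    ... | yes (x , x∈S , 0<η) = let D , D-circ , D⊆ = rec x∈S 0<η in D , D-circ , p─q⊆p S ⁅ x ⁆ ∘ D⊆
    ... | no none = S , (S-dep , S-minimal) , id
      where
      S-dep : Dependent M S
      S-dep S-indep = <⇒≢ 0<ηS (sym (independent⇒η≡0 S-indep))
      S-minimal : ∀ D → D ⊂ S → Independent M D
      S-minimal D (D⊆S , x , x∈S , x∉D) = η≡0⇒independent (n≤0⇒n≡0 (begin
        η D       ≤⟨ η-mono (λ y∈D → x∈p∧x≢y⇒x∈p-y (D⊆S y∈D) λ { refl → x∉D y∈D }) ⟩
        η (S - x) ≤⟨ ≮⇒≥ (λ 0<η → none (x , x∈S , 0<η)) ⟩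
        0         ∎))
        where open ≤-Reasoning

  modular-elimination : Circuit M C → Circuit M D → η (C ∪ D) ≡ 2 → z ∈ C → p ∈ D → p ∉ C →
                        ∃[ E ] Circuit M E × E ⊆ (C ∪ D) - z × p ∈ E
  modular-elimination {C} {D} {z} {p} C-circ D-circ η≡2 z∈C p∈D p∉C with circuit-⊆ ((C ∪ D) - z) 0<η[T-z]
    where
    0<η[T-z] : 0 < η ((C ∪ D) - z)
    0<η[T-z] = s≤s⁻¹ (≤-reflexive (trans (sym η≡2) (η-remove-circuit-point C-circ (p⊆p∪q D) z∈C)))
  ... | E , E-circ , E⊆T-z = E , E-circ , E⊆T-z , p∈E
    where
    C⊆T-p : C ⊆ (C ∪ D) - p
    C⊆T-p x∈C = x∈p∧x≢y⇒x∈p-y (p⊆p∪q D x∈C) λ { refl → p∉C x∈C }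
    η[T-p-z]≡0 : η ((C ∪ D) - p - z) ≡ 0
    η[T-p-z]≡0 = suc-injective (suc-injective (sym (begin
      2                             ≡⟨ η≡2 ⟨
      η (C ∪ D)                     ≡⟨ η-remove-circuit-point D-circ (q⊆p∪q C D) p∈D ⟩
      suc (η ((C ∪ D) - p))         ≡⟨ cong suc (η-remove-circuit-point C-circ C⊆T-p z∈C) ⟩
      suc (suc (η ((C ∪ D) - p - z))) ∎)))
      where open ≡-Reasoning
    p∈E : p ∈ E
    p∈E with p ∈? E
    ... | yes p∈E = p∈E
    ... | no p∉E  = contradiction (begin
        1                      ≡⟨ η-circuit E-circ ⟨
        η E                    ≤⟨ η-mono E⊆T-p-z ⟩
        η ((C ∪ D) - p - z)    ≡⟨ η[T-p-z]≡0 ⟩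
        0                      ∎) λ ()
      where
      open ≤-Reasoning
      E⊆T-p-z : E ⊆ (C ∪ D) - p - z
      E⊆T-p-z x∈E = let x∈T , x≢z = x∈p-y⁻ (E⊆T-z x∈E) in
        x∈p∧x≢y⇒x∈p-y (x∈p∧x≢y⇒x∈p-y x∈T λ { refl → p∉E x∈E }) x≢z

  record PrivateCircuits (𝒦 : Subset k) (F : Fin k → Subset n) (π : Fin k → Fin n) : Set where
    field
      circuit   : ∀ {j} → j ∈ 𝒦 → Circuit M (F j)
      π∈F       : ∀ {j} → j ∈ 𝒦 → π j ∈ F j
      π-private : ∀ {j l} → j ∈ 𝒦 → l ∈ 𝒦 → π j ∈ F l → j ≡ l

    π∉F : ∀ {j l} → j ∈ 𝒦 → l ∈ 𝒦 → l ≢ j → π j ∉ F l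
    π∉F j∈ l∈ l≢j πj∈Fl = l≢j (sym (π-private j∈ l∈ πj∈Fl))

  PrivateCircuits-⊆ : 𝒦′ ⊆ 𝒦 → PrivateCircuits 𝒦 F π → PrivateCircuits 𝒦′ F π
  PrivateCircuits-⊆ 𝒦′⊆𝒦 P = record
    { circuit   = circuit ∘ 𝒦′⊆𝒦
    ; π∈F       = π∈F ∘ 𝒦′⊆𝒦
    ; π-private = λ j∈ l∈ → π-private (𝒦′⊆𝒦 j∈) (𝒦′⊆𝒦 l∈)
    }
    where open PrivateCircuits P

  η+∣𝒦∣≤η : ∀ {k} {𝒦 : Subset k} {F : Fin k → Subset n} {π : Fin k → Fin n} {X U} →
            PrivateCircuits 𝒦 F π → X ⊆ U → (∀ {j} → j ∈ 𝒦 → F j ⊆ U) →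
            (∀ {j} → j ∈ 𝒦 → π j ∉ X) → η X + ∣ 𝒦 ∣ ≤ η U
  η+∣𝒦∣≤η {k} {𝒦} {F} {π} {X} = subset-rec Bound step 𝒦
    where
    Bound : Subset k → Set
    Bound 𝒦 = ∀ {U} → PrivateCircuits 𝒦 F π → X ⊆ U → (∀ {j} → j ∈ 𝒦 → F j ⊆ U) →
              (∀ {j} → j ∈ 𝒦 → π j ∉ X) → η X + ∣ 𝒦 ∣ ≤ η U
    open ≤-Reasoning
    step : ∀ 𝒦 → (∀ {j} → j ∈ 𝒦 → Bound (𝒦 - j)) → Bound 𝒦
    step 𝒦 rec {U} P X⊆U F⊆U π∉X with nonempty? 𝒦
    ... | no 𝒦-empty = begin
      η X + ∣ 𝒦 ∣ ≡⟨ cong (η X +_) (trans (cong ∣_∣ (Empty-unique 𝒦-empty)) (∣⊥∣≡0 k)) ⟩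
      η X + 0     ≡⟨ +-identityʳ (η X) ⟩
      η X         ≤⟨ η-mono X⊆U ⟩
      η U         ∎
    ... | yes (j , j∈𝒦) = begin
      η X + ∣ 𝒦 ∣           ≡⟨ cong (η X +_) (∣p∣≡1+∣p-x∣ 𝒦 j∈𝒦) ⟩
      η X + suc ∣ 𝒦 - j ∣   ≡⟨ +-suc (η X) ∣ 𝒦 - j ∣ ⟩
      suc (η X + ∣ 𝒦 - j ∣) ≤⟨ s≤s (rec j∈𝒦 (PrivateCircuits-⊆ 𝒦-j⊆𝒦 P) X⊆U-πj F⊆U-πj (π∉X ∘ 𝒦-j⊆𝒦)) ⟩
      suc (η (U - π j))     ≡⟨ η-remove-circuit-point (circuit j∈𝒦) (F⊆U j∈𝒦) (π∈F j∈𝒦) ⟨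
      η U                   ∎
      where
      open PrivateCircuits P
      𝒦-j⊆𝒦 : 𝒦 - j ⊆ 𝒦
      𝒦-j⊆𝒦 = p─q⊆p 𝒦 ⁅ j ⁆
      X⊆U-πj : X ⊆ U - π j
      X⊆U-πj x∈X = x∈p∧x≢y⇒x∈p-y (X⊆U x∈X) λ { refl → π∉X j∈𝒦 x∈X }
      F⊆U-πj : ∀ {l} → l ∈ 𝒦 - j → F l ⊆ U - π j
      F⊆U-πj l∈ x∈Fl = let l∈𝒦 , l≢j = x∈p-y⁻ l∈ in
        x∈p∧x≢y⇒x∈p-y (F⊆U l∈𝒦 x∈Fl) λ { refl → π∉F j∈𝒦 l∈𝒦 l≢j x∈Fl }

  -- A perfect collection with chosen private points, its union relaxed to any superset U:
  -- this is the form that survives deleting a point z from U in the induction below.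
  record PerfectIn (U : Subset n) (𝒦 : Subset k) (F : Fin k → Subset n) (π : Fin k → Fin n) : Set where
    field
      privateCircuits : PrivateCircuits 𝒦 F π
      F⊆U             : ∀ {j} → j ∈ 𝒦 → F j ⊆ U
      η≤∣𝒦∣           : η U ≤ ∣ 𝒦 ∣

    open PrivateCircuits privateCircuits public

  PerfectIn⇒modular : PerfectIn U 𝒦 F π → i ∈ 𝒦 → j ∈ 𝒦 → i ≢ j → η (F i ∪ F j) ≡ 2
  PerfectIn⇒modular {U = U} {𝒦 = 𝒦} {F = F} {π = π} {i = i} {j = j} P i∈𝒦 j∈𝒦 i≢j =
    ≤-antisym upper lower
    where
    open PerfectIn P
    open ≤-Reasoning
    lower : 2 ≤ η (F i ∪ F j)
    lower = begin
      2                           ≡⟨ cong suc (η-circuit (circuit i∈𝒦)) ⟨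
      suc (η (F i))               ≤⟨ s≤s (η-mono Fi⊆) ⟩
      suc (η ((F i ∪ F j) - π j)) ≡⟨ η-remove-circuit-point (circuit j∈𝒦) (q⊆p∪q (F i) (F j)) (π∈F j∈𝒦) ⟨
      η (F i ∪ F j)               ∎
      where
      Fi⊆ : F i ⊆ (F i ∪ F j) - π j
      Fi⊆ x∈Fi = x∈p∧x≢y⇒x∈p-y (p⊆p∪q (F j) x∈Fi) λ { refl → π∉F j∈𝒦 i∈𝒦 i≢j x∈Fi }
    j∈𝒦-i : j ∈ 𝒦 - i
    j∈𝒦-i = x∈p∧x≢y⇒x∈p-y j∈𝒦 (i≢j ∘ sym)
    𝒦-i-j⊆𝒦 : 𝒦 - i - j ⊆ 𝒦
    𝒦-i-j⊆𝒦 = p─q⊆p 𝒦 ⁅ i ⁆ ∘ p─q⊆p (𝒦 - i) ⁅ j ⁆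
    πl∉Fi∪Fj : ∀ {l} → l ∈ 𝒦 - i - j → π l ∉ F i ∪ F j
    πl∉Fi∪Fj l∈ πl∈ with x∈p-y⁻ l∈
    ... | l∈𝒦-i , l≢j with x∈p-y⁻ l∈𝒦-i
    ...   | l∈𝒦 , l≢i with x∈p∪q⁻ (F i) (F j) πl∈
    ...     | inj₁ πl∈Fi = π∉F l∈𝒦 i∈𝒦 (l≢i ∘ sym) πl∈Fi
    ...     | inj₂ πl∈Fj = π∉F l∈𝒦 j∈𝒦 (l≢j ∘ sym) πl∈Fj
    upper : η (F i ∪ F j) ≤ 2
    upper = +-cancelʳ-≤ ∣ 𝒦 - i - j ∣ _ _ (begin
      η (F i ∪ F j) + ∣ 𝒦 - i - j ∣
        ≤⟨ η+∣𝒦∣≤η (PrivateCircuits-⊆ 𝒦-i-j⊆𝒦 privateCircuits) (∪-lub (F⊆U i∈𝒦) (F⊆U j∈𝒦))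
                   (F⊆U ∘ 𝒦-i-j⊆𝒦) πl∉Fi∪Fj ⟩
      η U                     ≤⟨ η≤∣𝒦∣ ⟩
      ∣ 𝒦 ∣                   ≡⟨ ∣p∣≡1+∣p-x∣ 𝒦 i∈𝒦 ⟩
      suc ∣ 𝒦 - i ∣           ≡⟨ cong suc (∣p∣≡1+∣p-x∣ (𝒦 - i) j∈𝒦-i) ⟩
      2 + ∣ 𝒦 - i - j ∣       ∎)

  PerfectIn-shrink : ∀ {G : Fin k → Subset n} → PerfectIn U 𝒦 F π → i ∈ 𝒦 → z ∈ F i →
                     (∀ {j} → j ∈ 𝒦 - i → Circuit M (G j) × G j ⊆ (F i ∪ F j) - z × π j ∈ G j) →
                     PerfectIn (U - z) (𝒦 - i) G π
  PerfectIn-shrink {U = U} {𝒦 = 𝒦} {F = F} {π = π} {i = i} {z = z} {G = G} P i∈𝒦 z∈Fi G-spec = record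
    { privateCircuits = record
      { circuit   = proj₁ ∘ G-spec
      ; π∈F       = proj₂ ∘ proj₂ ∘ G-spec
      ; π-private = λ j∈ l∈ πj∈Gl → πj∈Gl⇒j≡l j∈ l∈ πj∈Gl
      }
    ; F⊆U   = λ j∈ → p⊆q⇒p-x⊆q-x z (∪-lub (F⊆U i∈𝒦) (F⊆U (𝒦-i⊆𝒦 j∈))) ∘ proj₁ (proj₂ (G-spec j∈))
    ; η≤∣𝒦∣ = s≤s⁻¹ (begin
        suc (η (U - z)) ≡⟨ η-remove-circuit-point (circuit i∈𝒦) (F⊆U i∈𝒦) z∈Fi ⟨
        η U             ≤⟨ η≤∣𝒦∣ ⟩
        ∣ 𝒦 ∣           ≡⟨ ∣p∣≡1+∣p-x∣ 𝒦 i∈𝒦 ⟩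
        suc ∣ 𝒦 - i ∣   ∎)
    }
    where
    open PerfectIn P
    open ≤-Reasoning
    𝒦-i⊆𝒦 : 𝒦 - i ⊆ 𝒦
    𝒦-i⊆𝒦 = p─q⊆p 𝒦 ⁅ i ⁆
    πj∈Gl⇒j≡l : ∀ {j l} → j ∈ 𝒦 - i → l ∈ 𝒦 - i → π j ∈ G l → j ≡ l
    πj∈Gl⇒j≡l {j} {l} j∈ l∈ πj∈Gl with x∈p-y⁻ j∈
    ... | j∈𝒦 , j≢i with x∈p∪q⁻ (F i) (F l) (p─q⊆p _ ⁅ z ⁆ (proj₁ (proj₂ (G-spec l∈)) πj∈Gl))
    ...   | inj₁ πj∈Fi = contradiction πj∈Fi (π∉F j∈𝒦 i∈𝒦 (j≢i ∘ sym))
    ...   | inj₂ πj∈Fl = π-private j∈𝒦 (𝒦-i⊆𝒦 l∈) πj∈Fl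

module Closure {k : ℕ} (N : Matroid k) where

  private
    variable
      A B : Subset k
      d i j : Fin k

  ∈⇒∈cl : i ∈ A → i ∈cl[ N ] A
  ∈⇒∈cl {i} {A} i∈A = ≤-antisym (r-mono N (∪-lub ⊆-refl ⁅i⁆⊆A)) (r-mono N (p⊆p∪q ⁅ i ⁆))
    where
    ⁅i⁆⊆A : ⁅ i ⁆ ⊆ A
    ⁅i⁆⊆A x∈⁅i⁆ = subst (_∈ A) (sym (x∈⁅y⁆⇒x≡y i x∈⁅i⁆)) i∈A

  ∈cl-mono : A ⊆ B → i ∈cl[ N ] A → i ∈cl[ N ] B
  ∈cl-mono {A} {B} {i} A⊆B i∈clA = ≤-antisym (+-cancelʳ-≤ (r N A) _ _ rank≤) (r-mono N (p⊆p∪q ⁅ i ⁆))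
    where
    open ≤-Reasoning
    rank≤ : r N (B ∪ ⁅ i ⁆) + r N A ≤ r N B + r N A
    rank≤ = begin
      r N (B ∪ ⁅ i ⁆) + r N A
        ≤⟨ +-mono-≤ (r-mono N (∪-lub (p⊆p∪q _) (q⊆p∪q B _ ∘ q⊆p∪q A ⁅ i ⁆)))
                    (r-mono N (λ x∈A → x∈p∩q⁺ (A⊆B x∈A , p⊆p∪q ⁅ i ⁆ x∈A))) ⟩
      r N (B ∪ (A ∪ ⁅ i ⁆)) + r N (B ∩ (A ∪ ⁅ i ⁆)) ≤⟨ r-submod N B (A ∪ ⁅ i ⁆) ⟩
      r N B + r N (A ∪ ⁅ i ⁆)                       ≡⟨ cong (r N B +_) i∈clA ⟩
      r N B + r N A                                 ∎

  ∈cl-trans : d ∈cl[ N ] A → i ∈cl[ N ] (A ∪ ⁅ d ⁆) → i ∈cl[ N ] A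
  ∈cl-trans {d} {A} {i} d∈clA i∈cl = ≤-antisym rank≤ (r-mono N (p⊆p∪q ⁅ i ⁆))
    where
    open ≤-Reasoning
    rank≤ : r N (A ∪ ⁅ i ⁆) ≤ r N A
    rank≤ = begin
      r N (A ∪ ⁅ i ⁆)           ≤⟨ r-mono N (∪-lub (p⊆p∪q ⁅ i ⁆ ∘ p⊆p∪q ⁅ d ⁆) (q⊆p∪q _ ⁅ i ⁆)) ⟩
      r N ((A ∪ ⁅ d ⁆) ∪ ⁅ i ⁆) ≡⟨ i∈cl ⟩
      r N (A ∪ ⁅ d ⁆)           ≡⟨ d∈clA ⟩
      r N A                     ∎

  ∈cl-⁅i⁆∪⁅j⁆ : i ∈cl[ N ] A → j ∈cl[ N ] A → d ∈cl[ N ] (⁅ i ⁆ ∪ ⁅ j ⁆) → d ∈cl[ N ] A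
  ∈cl-⁅i⁆∪⁅j⁆ {i} {A} {j} i∈clA j∈clA d∈cl =
    ∈cl-trans i∈clA (∈cl-trans (∈cl-mono (p⊆p∪q ⁅ i ⁆) j∈clA) (∈cl-mono ⁅i⁆∪⁅j⁆⊆ d∈cl))
    where
    ⁅i⁆∪⁅j⁆⊆ : ⁅ i ⁆ ∪ ⁅ j ⁆ ⊆ (A ∪ ⁅ i ⁆) ∪ ⁅ j ⁆
    ⁅i⁆∪⁅j⁆⊆ = ∪-lub (p⊆p∪q ⁅ j ⁆ ∘ q⊆p∪q A ⁅ i ⁆) (q⊆p∪q _ ⁅ j ⁆)

module _ {n m : ℕ} {M : Matroid n} {e : Fin m → Subset n} (enum : CircuitEnumeration M e) where

  open Nullity M
  open CircuitEnumeration enum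

  private
    variable
      i j : Fin m
      p z : Fin n

  e-incomparable : i ≢ j → ¬ e i ⊆ e j
  e-incomparable {i} {j} i≢j ei⊆ej = i≢j (injective (circuit-⊆⇒≡ (isCircuit i) (isCircuit j) ei⊆ej))

  modular-pair-perfect : ModularPair M e i j → Perfect M e (⁅ i ⁆ ∪ ⁅ j ⁆)
  modular-pair-perfect {i} {j} η≡2 = η≡∣⁅i⁆∪⁅j⁆∣ , irredundant
    where
    ⁅i⁆∪⁅j⁆⊈circuit : ∀ {l} → ¬ e i ∪ e j ⊆ e l
    ⁅i⁆∪⁅j⁆⊈circuit {l} ⊆el = contradiction (η-mono ⊆el) λ η≤ →
      <⇒≱ (n<1+n 1) (subst₂ _≤_ η≡2 (η-circuit (isCircuit l)) η≤)
    i≢j : i ≢ j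
    i≢j refl = ⁅i⁆∪⁅j⁆⊈circuit (∪-lub ⊆-refl ⊆-refl)
    η≡∣⁅i⁆∪⁅j⁆∣ : η (⋃[ e ] (⁅ i ⁆ ∪ ⁅ j ⁆)) ≡ ∣ ⁅ i ⁆ ∪ ⁅ j ⁆ ∣
    η≡∣⁅i⁆∪⁅j⁆∣ = trans (cong η (⋃-⁅i⁆∪⁅j⁆ e i j)) (trans η≡2 (sym (∣⁅x⁆∪⁅y⁆∣≡2 i≢j)))
    irredundant : ∀ l → l ∈ ⁅ i ⁆ ∪ ⁅ j ⁆ → ¬ e l ⊆ ⋃[ e ] ((⁅ i ⁆ ∪ ⁅ j ⁆) - l)
    irredundant l l∈ el⊆ with ⁅x⁆∪⁅y⁆⁻ l∈
    ... | inj₁ refl = ⁅i⁆∪⁅j⁆⊈circuit (∪-lub (⋃[⁅i⁆∪⁅j⁆-i]⊆ e i j ∘ el⊆) ⊆-refl)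
    ... | inj₂ refl = ⁅i⁆∪⁅j⁆⊈circuit (∪-lub ⊆-refl (⋃[⁅i⁆∪⁅j⁆-i]⊆ e j i ∘ ej⊆))
      where
      ej⊆ : e j ⊆ ⋃[ e ] ((⁅ j ⁆ ∪ ⁅ i ⁆) - j)
      ej⊆ = subst (λ 𝒞 → e j ⊆ ⋃[ e ] (𝒞 - j)) (∪-comm ⁅ i ⁆ ⁅ j ⁆) el⊆

  Star⇒Star' : ∀ N → Star M e N → Star' M e N
  Star⇒Star' N star i j η≡2 k ek⊆ = star (⁅ i ⁆ ∪ ⁅ j ⁆) (modular-pair-perfect η≡2) k
    (subst (e k ⊆_) (sym (⋃-⁅i⁆∪⁅j⁆ e i j)) ek⊆)

  Perfect⇒PerfectIn : ∀ {𝒞} → Perfect M e 𝒞 → ∃[ π ] PerfectIn (⋃[ e ] 𝒞) 𝒞 e π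
  Perfect⇒PerfectIn {𝒞} (η≡∣𝒞∣ , irredundant) = π , record
    { privateCircuits = record
      { circuit   = λ {j} _ → isCircuit j
      ; π∈F       = proj₁ ∘ π-spec
      ; π-private = π-private
      }
    ; F⊆U   = C⊆⋃ e
    ; η≤∣𝒦∣ = ≤-reflexive η≡∣𝒞∣
    }
    where
    private-point : ∀ {j} → j ∈ 𝒞 → ∃[ x ] x ∈ e j × x ∉ ⋃[ e ] (𝒞 - j)
    private-point {j} j∈𝒞 = p⊈q⇒∃ (irredundant j j∈𝒞)
    πs : ∃[ π ] (∀ {j} → j ∈ 𝒞 → π j ∈ e j × π j ∉ ⋃[ e ] (𝒞 - j))
    -- π is junk outside 𝒞; a point of the possibly empty Fin n is taken from the circuit e j.
    πs = choice 𝒞 (proj₁ ∘ circuit-nonempty ∘ isCircuit) private-point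
    π : Fin m → Fin n
    π = proj₁ πs
    π-spec : ∀ {j} → j ∈ 𝒞 → π j ∈ e j × π j ∉ ⋃[ e ] (𝒞 - j)
    π-spec = proj₂ πs
    π-private : ∀ {j l} → j ∈ 𝒞 → l ∈ 𝒞 → π j ∈ e l → j ≡ l
    π-private {j} {l} j∈𝒞 l∈𝒞 πj∈el with j ≟ l
    ... | yes j≡l = j≡l
    ... | no j≢l  = contradiction (C⊆⋃ e (x∈p∧x≢y⇒x∈p-y l∈𝒞 (j≢l ∘ sym)) πj∈el) (proj₂ (π-spec j∈𝒞))

  module _ (N : Matroid m) (star' : Star' M e N) where

    open Closure N

    modular-elimination-∈cl : η (e i ∪ e j) ≡ 2 → z ∈ e i → p ∈ e j → p ∉ e i →
                              ∃[ d ] (e d ⊆ (e i ∪ e j) - z × p ∈ e d) × d ∈cl[ N ] (⁅ i ⁆ ∪ ⁅ j ⁆)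
    modular-elimination-∈cl {i} {j} {z} η≡2 z∈ei p∈ej p∉ei
      with modular-elimination (isCircuit i) (isCircuit j) η≡2 z∈ei p∈ej p∉ei
    ... | E , E-circ , E⊆ , p∈E with onto E E-circ
    ...   | d , refl = d , (E⊆ , p∈E) , star' i j η≡2 d (p─q⊆p (e i ∪ e j) ⁅ z ⁆ ∘ E⊆)

    PerfectIn⇒∈cl : ∀ {π : Fin m → Fin n} {𝒜 : Subset m} 𝒥 {c : Fin m → Fin m} {U} →
                    PerfectIn U 𝒥 (e ∘ c) π → (∀ {j} → j ∈ 𝒥 → c j ∈cl[ N ] 𝒜) →
                    ∀ k → e k ⊆ U → k ∈cl[ N ] 𝒜
    PerfectIn⇒∈cl {π} {𝒜} = subset-rec Claim step
      where
      Claim : Subset m → Set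
      Claim 𝒥 = ∀ {c U} → PerfectIn U 𝒥 (e ∘ c) π → (∀ {j} → j ∈ 𝒥 → c j ∈cl[ N ] 𝒜) →
                ∀ k → e k ⊆ U → k ∈cl[ N ] 𝒜
      step : ∀ 𝒥 → (∀ {i} → i ∈ 𝒥 → Claim (𝒥 - i)) → Claim 𝒥
      step 𝒥 rec {c} {U} P c∈cl k ek⊆U with nonempty? 𝒥
      ... | no 𝒥-empty = contradiction (begin
          1         ≡⟨ η-circuit (isCircuit k) ⟨
          η (e k)   ≤⟨ η-mono ek⊆U ⟩
          η U       ≤⟨ η≤∣𝒦∣ ⟩
          ∣ 𝒥 ∣     ≡⟨ trans (cong ∣_∣ (Empty-unique 𝒥-empty)) (∣⊥∣≡0 m) ⟩
          0         ∎) λ ()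
        where
        open PerfectIn P
        open ≤-Reasoning
      ... | yes (i , i∈𝒥) with k ≟ c i
      ...   | yes refl = c∈cl i∈𝒥
      ...   | no k≢ci with p⊈q⇒∃ (e-incomparable (k≢ci ∘ sym))
      ...     | z , z∈eci , z∉ek =
        rec i∈𝒥 (PerfectIn-shrink P i∈𝒥 z∈eci (λ {j} j∈ → isCircuit (c′ j) , proj₁ (c′-spec j∈)))
                (λ j∈ → ∈cl-⁅i⁆∪⁅j⁆ (c∈cl i∈𝒥) (c∈cl (𝒥-i⊆𝒥 j∈)) (proj₂ (c′-spec j∈)))
                k ek⊆U-z
        where
        open PerfectIn P
        𝒥-i⊆𝒥 : 𝒥 - i ⊆ 𝒥
        𝒥-i⊆𝒥 = p─q⊆p 𝒥 ⁅ i ⁆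
        ek⊆U-z : e k ⊆ U - z
        ek⊆U-z x∈ek = x∈p∧x≢y⇒x∈p-y (ek⊆U x∈ek) λ { refl → z∉ek x∈ek }
        eliminate : ∀ {j} → j ∈ 𝒥 - i → ∃[ d ] (e d ⊆ (e (c i) ∪ e (c j)) - z × π j ∈ e d) ×
                                              d ∈cl[ N ] (⁅ c i ⁆ ∪ ⁅ c j ⁆)
        eliminate j∈ = let j∈𝒥 , j≢i = x∈p-y⁻ j∈ in
          modular-elimination-∈cl (PerfectIn⇒modular P i∈𝒥 j∈𝒥 (j≢i ∘ sym)) z∈eci (π∈F j∈𝒥)
                                  (π∉F j∈𝒥 i∈𝒥 (j≢i ∘ sym))
        c′ : Fin m → Fin m
        c′ = proj₁ (choice (𝒥 - i) c eliminate)
        c′-spec : ∀ {j} → j ∈ 𝒥 - i → (e (c′ j) ⊆ (e (c i) ∪ e (c j)) - z × π j ∈ e (c′ j)) ×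
                                       c′ j ∈cl[ N ] (⁅ c i ⁆ ∪ ⁅ c j ⁆)
        c′-spec = proj₂ (choice (𝒥 - i) c eliminate)

    Star'⇒Star : Star M e N
    Star'⇒Star 𝒞 𝒞-perfect = PerfectIn⇒∈cl 𝒞 (proj₂ (Perfect⇒PerfectIn 𝒞-perfect)) ∈⇒∈cl

proposition2p2 : (n m : ℕ) (M : Matroid n) (e : Fin m → Subset n)
                 → CircuitEnumeration M e
                 → (N : Matroid m)
                 → Star' M e N ⇔ Star M e N
proposition2p2 n m M e enum N = mk⇔ (Star'⇒Star enum N) (Star⇒Star' enum N)
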